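{- The sets $$D_3=\left\{\frac{x_n}{x_{n-1}}:\ (x_1,\ldots,x_n)\in S_3(n),\ n\geq 3\right\}\quad\text{and}\quad D=\left\{\frac{x_n}{x_{n-1}}:\ (x_1,\ldots,x_n)\in S(n),\ n\geq 3\right\}$$ are dense in $[1,+\infty)$.
   Context: $\sigma_k$ denotes the $k$-th elementary symmetric polynomial in $n$ variables. $S(n)$ is the set of $n$-tuples $(x_1,\ldots,x_n)$ of positive integers with $x_1\leq\cdots\leq x_n$ and $\sigma_2(x_1,\ldots,x_n)=\sigma_n(x_1,\ldots,x_n)$; $S_3(n)$ is the subset of those with $x_1=\cdots=x_{n-3}=1$ and $2\leq x_{n-2}$. (The paper's definition of $D_3$ fixes no $n$; the union over all $n\geq 3$ is intended, as in $D$.) -}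

module Defs where

open import Data.Nat using (ℕ; zero; suc; _+_; _*_; _≤_; _<_)
open import Data.Integer using (+_)
open import Data.Rational using (ℚ; _/_; 0ℚ)
import Data.Rational as ℚ
open import Data.List using (List; []; _∷_)
open import Data.Nat.ListAction using (sum; product)
open import Data.List.Relation.Unary.All using (All)
open import Data.List.Relation.Unary.Linked using (Linked)
open import Data.Vec using (Vec; toList; take; drop; lookup; replicate)
open import Data.Fin using (Fin; zero; suc)
open import Data.Product using (_×_; ∃-syntax; Σ-syntax)
open import Relation.Binary.PropositionalEquality using (_≡_)

σ₂ : List ℕ → ℕ
σ₂ [] = 0
σ₂ (x ∷ xs) = x * sum xs + σ₂ xs

σₙ : List ℕ → ℕ
σₙ = product

-- S(n), for n = m + 3: positive, nondecreasing, σ₂ = σₙ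
InS : (m : ℕ) → Vec ℕ (m + 3) → Set
InS m v = All (λ x → 0 < x) (toList v)
        × Linked _≤_ (toList v)
        × σ₂ (toList v) ≡ σₙ (toList v)

xₙ₋₂ xₙ₋₁ xₙ : (m : ℕ) → Vec ℕ (m + 3) → ℕ
xₙ₋₂ m v = lookup (drop m v) zero
xₙ₋₁ m v = lookup (drop m v) (suc zero)
xₙ m v = lookup (drop m v) (suc (suc zero))

InS₃ : (m : ℕ) → Vec ℕ (m + 3) → Set
InS₃ m v = InS m v × take m v ≡ replicate m 1 × 2 ≤ xₙ₋₂ m v

-- a / b as a rational (b is always positive in our use; b = 0 gives 0 as a dummy)
frac : ℕ → ℕ → ℚ
frac a zero = 0ℚ
frac a (suc b) = (+ a) / suc b

ratio : (m : ℕ) → Vec ℕ (m + 3) → ℚ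
ratio m v = frac (xₙ m v) (xₙ₋₁ m v)

InD : ℚ → Set
InD r = ∃[ m ] Σ[ v ∈ Vec ℕ (m + 3) ] (InS m v × ratio m v ≡ r)

InD₃ : ℚ → Set
InD₃ r = ∃[ m ] Σ[ v ∈ Vec ℕ (m + 3) ] (InS₃ m v × ratio m v ≡ r)

-- A ⊆ ℚ is dense in [1, +∞): A ⊆ [1,∞) and every nonempty open
-- interval (p, q) with 1 ≤ p meets A (rational endpoints suffice, ℚ being dense in ℝ)
DenseInOneInfty : (ℚ → Set) → Set
DenseInOneInfty A =
  (∀ r → A r → ℚ.1ℚ ℚ.≤ r)
  × (∀ p q → ℚ.1ℚ ℚ.≤ p → p ℚ.< q → ∃[ r ] (A r × p ℚ.< r × r ℚ.< q))

module Submission where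

-- Padding a triple a ≤ b ≤ c with k ones gives a tuple in S exactly when
-- k(k − 1)/2 + k(a + b + c) + ab + ac + bc = abc. With u = x + 1 and w = y + 2 the triple
-- a = 2u(w − 1), b = (4u + 1)w + 1, c = u(4u + 3) admits such a k for all x, y, and
-- u/w < c/b < c/((4u + 1)w) = (u/w)(4u + 3)/(4u + 1).
-- For rationals 1 ≤ P/Q < P′/Q′ the choice u = 2PQ′, w = 2QQ′ gives u/w = P/Q, and
-- PQ′(4u + 3) = PQ′(4u + 1) + u ≤ (PQ′ + 1)(4u + 1) ≤ P′Q(4u + 1) puts the upper bound
-- below P′/Q′; P ≥ Q makes b < c.
-- Every ratio is at least 1 simply because x_{n−1} ≤ x_n.

open import Defs
open import Data.Product using (_×_; _,_; ∃-syntax; ∃₂; map₁; map₂)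
open import Function using (_∘_)
open import Data.Nat using (ℕ; zero; suc; _+_; _*_; _^_; _≤_; _<_; z≤n; s≤s)
import Data.Nat.Properties as ℕ
open import Data.Nat.Tactic.RingSolver using (solve-∀)
open import Data.Nat.ListAction using (sum; product)
open import Data.Nat.ListAction.Properties using (sum-++; product-++)
open import Data.List as L using (List)
open import Data.List.Relation.Unary.All as All using (All; _∷_)
open import Data.List.Relation.Unary.All.Properties using (++⁺; replicate⁺)
open import Data.List.Relation.Unary.Linked as Linked using (Linked; [-]; _∷_)
open import Data.Vec using (Vec; []; _∷_; _++_; toList; take; drop; replicate; lookup)
open import Data.Fin using (zero; suc)
open import Data.Vec.Properties using (toList-++; toList-replicate)
import Data.Integer as ℤ
import Data.Integer.Properties as ℤ
open import Data.Rational as ℚ using (mkℚ; 1ℚ)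
import Data.Rational.Properties as ℚ
open import Data.Rational.Unnormalised as ℚᵘ using (mkℚᵘ; _≃_; *≤*; *<*)
import Data.Rational.Unnormalised.Properties as ℚᵘ
open import Relation.Binary.PropositionalEquality

take-++ : ∀ {A : Set} {m n} (xs : Vec A m) (ys : Vec A n) → take m (xs ++ ys) ≡ xs
take-++ []       ys = refl
take-++ (x ∷ xs) ys = cong (x ∷_) (take-++ xs ys)

drop-++ : ∀ {A : Set} {m n} (xs : Vec A m) (ys : Vec A n) → drop m (xs ++ ys) ≡ ys
drop-++ []       ys = refl
drop-++ (x ∷ xs) ys = drop-++ xs ys

sum-replicate : ∀ n m → sum (L.replicate n m) ≡ n * m
sum-replicate zero    m = refl
sum-replicate (suc n) m = cong (m +_) (sum-replicate n m)

product-replicate : ∀ n m → product (L.replicate n m) ≡ m ^ n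
product-replicate zero    m = refl
product-replicate (suc n) m = cong (m *_) (product-replicate n m)

σ₂-++ : ∀ xs ys → σ₂ (xs L.++ ys) ≡ σ₂ xs + sum xs * sum ys + σ₂ ys
σ₂-++ L.[]       ys = refl
σ₂-++ (x L.∷ xs) ys = begin
  x * sum (xs L.++ ys) + σ₂ (xs L.++ ys)
    ≡⟨ cong₂ (λ s t → x * s + t) (sum-++ xs ys) (σ₂-++ xs ys) ⟩
  x * (sum xs + sum ys) + (σ₂ xs + sum xs * sum ys + σ₂ ys)
    ≡⟨ distribute x (sum xs) (sum ys) (σ₂ xs) (σ₂ ys) ⟩
  x * sum xs + σ₂ xs + (x + sum xs) * sum ys + σ₂ ys ∎
  where
  open ≡-Reasoning
  distribute : ∀ x s t σ τ → x * (s + t) + (σ + s * t + τ) ≡ x * s + σ + (x + s) * t + τ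
  distribute = solve-∀

σ₂-replicate-1 : ∀ k → 2 * σ₂ (L.replicate k 1) + k ≡ k * k
σ₂-replicate-1 zero    = refl
σ₂-replicate-1 (suc k) = begin
  2 * (1 * sum (L.replicate k 1) + σ₂ (L.replicate k 1)) + suc k
    ≡⟨ cong (λ s → 2 * (1 * s + σ₂ (L.replicate k 1)) + suc k) (trans (sum-replicate k 1) (ℕ.*-identityʳ k)) ⟩
  2 * (1 * k + σ₂ (L.replicate k 1)) + suc k
    ≡⟨ regroup k (σ₂ (L.replicate k 1)) ⟩
  2 * σ₂ (L.replicate k 1) + k + 2 * k + 1
    ≡⟨ cong (λ t → t + 2 * k + 1) (σ₂-replicate-1 k) ⟩
  k * k + 2 * k + 1
    ≡⟨ square k ⟩
  suc k * suc k ∎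
  where
  open ≡-Reasoning
  regroup : ∀ k σ → 2 * (1 * k + σ) + suc k ≡ 2 * σ + k + 2 * k + 1
  regroup = solve-∀
  square : ∀ k → k * k + 2 * k + 1 ≡ suc k * suc k
  square = solve-∀

-- Twice  k(k − 1)/2 + k·sum xs + σ₂ xs = product xs,  i.e. σ₂ = σₙ for xs padded with k ones.
Balanced : ℕ → List ℕ → Set
Balanced k xs = k * k + 2 * k * sum xs + 2 * σ₂ xs ≡ 2 * product xs + k

padded-σ₂≡product : ∀ k xs → Balanced k xs →
                    σ₂ (L.replicate k 1 L.++ xs) ≡ product (L.replicate k 1 L.++ xs)
padded-σ₂≡product k xs balanced = ℕ.*-cancelˡ-≡ _ _ 2 (ℕ.+-cancelʳ-≡ k _ _ (begin
  2 * σ₂ (ones L.++ xs) + k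
    ≡⟨ cong (λ t → 2 * t + k) (σ₂-++ ones xs) ⟩
  2 * (σ₂ ones + sum ones * sum xs + σ₂ xs) + k
    ≡⟨ cong (λ s → 2 * (σ₂ ones + s * sum xs + σ₂ xs) + k) (trans (sum-replicate k 1) (ℕ.*-identityʳ k)) ⟩
  2 * (σ₂ ones + k * sum xs + σ₂ xs) + k
    ≡⟨ regroup (σ₂ ones) k (sum xs) (σ₂ xs) ⟩
  (2 * σ₂ ones + k) + 2 * k * sum xs + 2 * σ₂ xs
    ≡⟨ cong (λ t → t + 2 * k * sum xs + 2 * σ₂ xs) (σ₂-replicate-1 k) ⟩
  k * k + 2 * k * sum xs + 2 * σ₂ xs
    ≡⟨ balanced ⟩
  2 * product xs + k
    ≡⟨ cong (λ t → 2 * t + k) (begin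
         product xs             ≡⟨ ℕ.*-identityˡ _ ⟨
         1 * product xs         ≡⟨ cong (_* product xs) (trans (product-replicate k 1) (ℕ.^-zeroˡ k)) ⟨
         product ones * product xs ≡⟨ product-++ ones xs ⟨
         product (ones L.++ xs) ∎) ⟩
  2 * product (ones L.++ xs) + k ∎))
  where
  open ≡-Reasoning
  ones = L.replicate k 1
  regroup : ∀ σ k s τ → 2 * (σ + k * s + τ) + k ≡ (2 * σ + k) + 2 * k * s + 2 * τ
  regroup = solve-∀

balanced-triple : ∀ k a b c → k * k + 2 * k * (a + b + c) + 2 * (a * b + a * c + b * c) ≡ 2 * (a * b * c) + k →
                  Balanced k (a L.∷ b L.∷ c L.∷ L.[])
balanced-triple k a b c = subst₂ _≡_ (lhs k a b c) (rhs k a b c)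
  where
  lhs : ∀ k a b c → k * k + 2 * k * (a + b + c) + 2 * (a * b + a * c + b * c)
                  ≡ k * k + 2 * k * (a + (b + (c + 0))) + 2 * (a * (b + (c + 0)) + (b * (c + 0) + (c * 0 + 0)))
  lhs = solve-∀
  rhs : ∀ k a b c → 2 * (a * b * c) + k ≡ 2 * (a * (b * (c * 1))) + k
  rhs = solve-∀

toList-padded : ∀ k {n} (v : Vec ℕ n) → toList (replicate k 1 ++ v) ≡ L.replicate k 1 L.++ toList v
toList-padded k v = trans (toList-++ (replicate k 1) v) (cong (L._++ toList v) (toList-replicate k 1))

linked-padded : ∀ k {x xs} → 1 ≤ x → Linked _≤_ (x L.∷ xs) → Linked _≤_ (L.replicate k 1 L.++ x L.∷ xs)
linked-padded zero          _   linked = linked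
linked-padded (suc zero)    1≤x linked = 1≤x ∷ linked
linked-padded (suc (suc k)) 1≤x linked = ℕ.≤-refl ∷ linked-padded (suc k) 1≤x linked

padded-InS₃ : ∀ k {a b c} → 2 ≤ a → a ≤ b → b ≤ c → Balanced k (a L.∷ b L.∷ c L.∷ L.[]) →
              InS₃ k (replicate k 1 ++ a ∷ b ∷ c ∷ [])
padded-InS₃ k {a} {b} {c} 2≤a a≤b b≤c balanced =
  ( subst (All (0 <_)) (sym (toList-padded k abc))
      (++⁺ (replicate⁺ k (s≤s z≤n)) (0<a ∷ ℕ.<-≤-trans 0<a a≤b ∷ ℕ.<-≤-trans 0<a (ℕ.≤-trans a≤b b≤c) ∷ All.[]))
  , subst (Linked _≤_) (sym (toList-padded k abc)) (linked-padded k 0<a (a≤b ∷ b≤c ∷ [-]))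
  , subst (λ xs → σ₂ xs ≡ product xs) (sym (toList-padded k abc)) (padded-σ₂≡product k _ balanced))
  , take-++ (replicate k 1) abc
  , subst (λ v → 2 ≤ lookup v zero) (sym (drop-++ (replicate k 1) abc)) 2≤a
  where
  abc = a ∷ b ∷ c ∷ []
  0<a : 0 < a
  0<a = ℕ.≤-trans (s≤s z≤n) 2≤a

padded-ratio : ∀ k (a b c : ℕ) → ratio k (replicate k 1 ++ a ∷ b ∷ c ∷ []) ≡ frac c b
padded-ratio k a b c =
  cong (λ v → frac (lookup v (suc (suc zero))) (lookup v (suc zero))) (drop-++ (replicate k 1) (a ∷ b ∷ c ∷ []))

toℚᵘ-frac : ∀ a b → ℚ.toℚᵘ (frac a (suc b)) ≃ mkℚᵘ (ℤ.+ a) b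
toℚᵘ-frac a b = ℚ.toℚᵘ-fromℚᵘ (mkℚᵘ (ℤ.+ a) b)

frac-≤-frac : ∀ {a b c d} → a * suc d ≤ c * suc b → frac a (suc b) ℚ.≤ frac c (suc d)
frac-≤-frac {a} {b} {c} {d} le = ℚ.toℚᵘ-cancel-≤
  (ℚᵘ.≤-respˡ-≃ (ℚᵘ.≃-sym (toℚᵘ-frac a b)) (ℚᵘ.≤-respʳ-≃ (ℚᵘ.≃-sym (toℚᵘ-frac c d))
    (*≤* (subst₂ ℤ._≤_ (ℤ.pos-* a (suc d)) (ℤ.pos-* c (suc b)) (ℤ.+≤+ le)))))

frac-≤-frac⁻¹ : ∀ a b c d → frac a (suc b) ℚ.≤ frac c (suc d) → a * suc d ≤ c * suc b
frac-≤-frac⁻¹ a b c d le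
  with ℚᵘ.≤-respˡ-≃ (toℚᵘ-frac a b) (ℚᵘ.≤-respʳ-≃ (toℚᵘ-frac c d) (ℚ.toℚᵘ-mono-≤ le))
... | *≤* h = ℤ.drop‿+≤+ (subst₂ ℤ._≤_ (sym (ℤ.pos-* a (suc d))) (sym (ℤ.pos-* c (suc b))) h)

frac-<-frac : ∀ {a b c d} → a * suc d < c * suc b → frac a (suc b) ℚ.< frac c (suc d)
frac-<-frac {a} {b} {c} {d} lt = ℚ.toℚᵘ-cancel-<
  (ℚᵘ.<-respˡ-≃ (ℚᵘ.≃-sym (toℚᵘ-frac a b)) (ℚᵘ.<-respʳ-≃ (ℚᵘ.≃-sym (toℚᵘ-frac c d))
    (*<* (subst₂ ℤ._<_ (ℤ.pos-* a (suc d)) (ℤ.pos-* c (suc b)) (ℤ.+<+ lt)))))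

frac-<-frac⁻¹ : ∀ a b c d → frac a (suc b) ℚ.< frac c (suc d) → a * suc d < c * suc b
frac-<-frac⁻¹ a b c d lt
  with ℚᵘ.<-respˡ-≃ (toℚᵘ-frac a b) (ℚᵘ.<-respʳ-≃ (toℚᵘ-frac c d) (ℚ.toℚᵘ-mono-< lt))
... | *<* h = ℤ.drop‿+<+ (subst₂ ℤ._<_ (sym (ℤ.pos-* a (suc d))) (sym (ℤ.pos-* c (suc b))) h)

1≤frac : ∀ {a b} → 0 < b → b ≤ a → 1ℚ ℚ.≤ frac a b
1≤frac {a} {suc b} _ b≤a =
  frac-≤-frac {1} {0} {a} {b} (subst₂ _≤_ (sym (ℕ.*-identityˡ (suc b))) (sym (ℕ.*-identityʳ a)) b≤a)

1≤frac⁻¹ : ∀ a b → 1ℚ ℚ.≤ frac a (suc b) → suc b ≤ a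
1≤frac⁻¹ a b le = subst₂ _≤_ (ℕ.*-identityˡ (suc b)) (ℕ.*-identityʳ a) (frac-≤-frac⁻¹ 1 0 a b le)

nonNegative⇒frac : ∀ p → ℚ.NonNegative p → ∃₂ λ n d → frac n (suc d) ≡ p
nonNegative⇒frac (mkℚ (ℤ.+ n) d _) _ = n , d , ℚ.↥p/↧p≡p _

1≤⇒frac : ∀ {p} → 1ℚ ℚ.≤ p → ∃₂ λ n d → frac n (suc d) ≡ p
1≤⇒frac {p} 1≤p = nonNegative⇒frac p (ℚ.nonNegative (ℚ.≤-trans (ℚ.nonNegative⁻¹ 1ℚ) 1≤p))

ratio-≥1 : ∀ m (v : Vec ℕ (m + 3)) → All (0 <_) (toList v) → Linked _≤_ (toList v) → 1ℚ ℚ.≤ ratio m v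
ratio-≥1 zero    (_ ∷ _ ∷ _ ∷ []) (_ ∷ 0<y ∷ _) (_ ∷ y≤z ∷ _) = 1≤frac 0<y y≤z
ratio-≥1 (suc m) (_ ∷ v)          (_ ∷ pos)    linked      = ratio-≥1 m v pos (Linked.tail linked)

InD⇒≥1 : ∀ r → InD r → 1ℚ ℚ.≤ r
InD⇒≥1 _ (m , v , (pos , linked , _) , refl) = ratio-≥1 m v pos linked

InD₃⇒InD : ∀ {r} → InD₃ r → InD r
InD₃⇒InD (m , v , (s , _) , eq) = m , v , s , eq

module Family (x y : ℕ) where

  -- k is the root of the quadratic equation  Balanced k (a ∷ b ∷ c ∷ [])  in k.
  u w a b c k : ℕ
  u = suc x
  w = 2 + y
  a = 2 * u * suc y
  b = suc ((4 * u + 1) * w)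
  c = u * (4 * u + 3)
  k = (2 * x * y + 2 * x + 2 * y) * (4 * x + 3) + 4 * x + 2

  tuple : Vec ℕ (k + 3)
  tuple = replicate k 1 ++ a ∷ b ∷ c ∷ []

  k-solves : k * k + 2 * k * (a + b + c) + 2 * (a * b + a * c + b * c) ≡ 2 * (a * b * c) + k
  k-solves = unfolded x y
    where
    -- the ring solver does not unfold definitions, so they are inlined here
    unfolded : ∀ x y →
      let u = suc x
          a = 2 * u * suc y
          b = suc ((4 * u + 1) * (2 + y))
          c = u * (4 * u + 3)
          k = (2 * x * y + 2 * x + 2 * y) * (4 * x + 3) + 4 * x + 2
      in k * k + 2 * k * (a + b + c) + 2 * (a * b + a * c + b * c) ≡ 2 * (a * b * c) + k
    unfolded = solve-∀

  2≤a : 2 ≤ a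
  2≤a = ℕ.≤-trans (ℕ.m≤m*n 2 u) (ℕ.m≤m*n (2 * u) (suc y))

  a≤b : a ≤ b
  a≤b = subst (a ≤_) (sym (b≡ u y)) (ℕ.m≤m+n a _)
    where
    b≡ : ∀ u y → suc ((4 * u + 1) * (2 + y)) ≡ 2 * u * suc y + (2 * u * suc y + 4 * u + y + 3)
    b≡ = solve-∀

  u*b<c*w : u * b < c * w
  u*b<c*w = subst (u * b <_) (sym (c*w≡ u y)) (ℕ.m<m+n (u * b) (s≤s z≤n))
    where
    c*w≡ : ∀ u y → u * (4 * u + 3) * (2 + y) ≡ u * suc ((4 * u + 1) * (2 + y)) + u * (3 + 2 * y)
    c*w≡ = solve-∀

  tuple∈S₃ : b ≤ c → InS₃ k tuple
  tuple∈S₃ b≤c = padded-InS₃ k 2≤a a≤b b≤c (balanced-triple k a b c k-solves)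

between-lower : ∀ {P Q Q′ u w b c} → u ≡ 2 * P * Q′ → w ≡ 2 * Q * Q′ → u * b < c * w → P * b < c * Q
between-lower {P} {Q} {Q′} {b = b} {c} refl refl u*b<c*w =
  ℕ.*-cancelˡ-< (2 * Q′) _ _ (subst₂ _<_ (left P Q′ b) (right Q Q′ c) u*b<c*w)
  where
  left : ∀ P Q′ b → 2 * P * Q′ * b ≡ 2 * Q′ * (P * b)
  left = solve-∀
  right : ∀ Q Q′ c → c * (2 * Q * Q′) ≡ 2 * Q′ * (c * Q)
  right = solve-∀

between-upper : ∀ {P Q P′ Q′ u w b c} → u ≡ 2 * P * Q′ → w ≡ 2 * Q * Q′ → c ≡ u * (4 * u + 3) →
                (4 * u + 1) * w < b → P * Q′ < P′ * Q → c * Q′ < P′ * b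
between-upper {P′ = zero} _ _ _ _ ()
between-upper {P} {Q} {P′@(suc _)} {Q′} {b = b} refl refl refl gap PQ′<P′Q = begin-strict
  2 * P * Q′ * (4 * (2 * P * Q′) + 3) * Q′
    ≡⟨ expand P Q′ ⟩
  2 * Q′ * (P * Q′ * (8 * P * Q′ + 1) + 2 * P * Q′)
    ≤⟨ ℕ.*-monoʳ-≤ (2 * Q′) (ℕ.+-monoʳ-≤ (P * Q′ * (8 * P * Q′ + 1)) 2PQ′≤8PQ′+1) ⟩
  2 * Q′ * (P * Q′ * (8 * P * Q′ + 1) + (8 * P * Q′ + 1))
    ≡⟨ factor P Q′ ⟩
  2 * Q′ * (suc (P * Q′) * (8 * P * Q′ + 1))
    ≤⟨ ℕ.*-monoʳ-≤ (2 * Q′) (ℕ.*-monoˡ-≤ (8 * P * Q′ + 1) PQ′<P′Q) ⟩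
  2 * Q′ * (P′ * Q * (8 * P * Q′ + 1))
    ≡⟨ regroup P Q P′ Q′ ⟩
  P′ * ((4 * (2 * P * Q′) + 1) * (2 * Q * Q′))
    <⟨ ℕ.*-monoʳ-< P′ gap ⟩
  P′ * b ∎
  where
  open ℕ.≤-Reasoning
  2PQ′≤8PQ′+1 : 2 * P * Q′ ≤ 8 * P * Q′ + 1
  2PQ′≤8PQ′+1 = ℕ.≤-trans (ℕ.*-monoˡ-≤ Q′ (ℕ.*-monoˡ-≤ P {2} {8} (s≤s (s≤s z≤n)))) (ℕ.m≤m+n _ 1)
  expand : ∀ P Q′ → 2 * P * Q′ * (4 * (2 * P * Q′) + 3) * Q′ ≡ 2 * Q′ * (P * Q′ * (8 * P * Q′ + 1) + 2 * P * Q′)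
  expand = solve-∀
  factor : ∀ P Q′ → 2 * Q′ * (P * Q′ * (8 * P * Q′ + 1) + (8 * P * Q′ + 1)) ≡ 2 * Q′ * (suc (P * Q′) * (8 * P * Q′ + 1))
  factor = solve-∀
  regroup : ∀ P Q P′ Q′ → 2 * Q′ * (P′ * Q * (8 * P * Q′ + 1)) ≡ P′ * ((4 * (2 * P * Q′) + 1) * (2 * Q * Q′))
  regroup = solve-∀

family-between : ∀ {P q P′ q′} → suc q ≤ P → P * suc q′ < P′ * suc q →
                 ∃₂ λ x y → let open Family x y in b ≤ c × P * b < c * suc q × c * suc q′ < P′ * b
family-between {P} {q} {P′} {q′} Q≤P PQ′<P′Q
  with ℕ.m≤n⇒∃[o]m+o≡n 1≤2PQ′ | ℕ.m≤n⇒∃[o]m+o≡n 2≤2QQ′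
  where
  1≤2PQ′ : 1 ≤ 2 * P * suc q′
  1≤2PQ′ = ℕ.≤-trans (s≤s z≤n) (ℕ.≤-trans Q≤P (ℕ.≤-trans (ℕ.m≤n*m P 2) (ℕ.m≤m*n (2 * P) (suc q′))))
  2≤2QQ′ : 2 ≤ 2 * suc q * suc q′
  2≤2QQ′ = ℕ.≤-trans (ℕ.m≤m*n 2 (suc q)) (ℕ.m≤m*n (2 * suc q) (suc q′))
... | x , u≡2PQ′ | y , w≡2QQ′ = x , y , b≤c , lower , upper
  where
  open Family x y
  upper : c * suc q′ < P′ * b
  upper = between-upper {P} {suc q} {P′} {suc q′} {u} {w} {b} {c} u≡2PQ′ w≡2QQ′ refl (ℕ.n<1+n _) PQ′<P′Q
  lower : P * b < c * suc q
  lower = between-lower {P} {suc q} {suc q′} {u} {w} {b} {c} u≡2PQ′ w≡2QQ′ u*b<c*w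
  b≤c : b ≤ c
  b≤c = ℕ.<⇒≤ (ℕ.*-cancelʳ-< (suc q) b c
          (ℕ.≤-<-trans (ℕ.≤-trans (ℕ.≤-reflexive (ℕ.*-comm b (suc q))) (ℕ.*-monoˡ-≤ b Q≤P)) lower))

D₃-dense : ∀ p q → 1ℚ ℚ.≤ p → p ℚ.< q → ∃[ r ] (InD₃ r × p ℚ.< r × r ℚ.< q)
D₃-dense p q 1≤p p<q with 1≤⇒frac 1≤p | 1≤⇒frac (ℚ.≤-trans 1≤p (ℚ.<⇒≤ p<q))
... | P , q₀ , refl | P′ , q₁ , refl
  with family-between {P} {q₀} {P′} {q₁} (1≤frac⁻¹ P q₀ 1≤p) (frac-<-frac⁻¹ P q₀ P′ q₁ p<q)
... | x , y , b≤c , lower , upper =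
  frac c b , (k , tuple , tuple∈S₃ b≤c , padded-ratio k a b c)
  , frac-<-frac {P} {q₀} {c} lower , frac-<-frac {c} {_} {P′} {q₁} upper
  where open Family x y

theorem3p5 : DenseInOneInfty InD₃ × DenseInOneInfty InD
theorem3p5 = ((λ r → InD⇒≥1 r ∘ InD₃⇒InD) , D₃-dense)
           , (InD⇒≥1 , λ p q 1≤p p<q → map₂ (map₁ InD₃⇒InD) (D₃-dense p q 1≤p p<q))
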